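{- Let $m,n,k,\ell$ be positive integers with $\lfloor m/n\rfloor\ge 2$. Then $\left|\mathcal{D}_{m,n}^{(k,\ell)}\right|=\left|\mathcal{D}_{m,n}^{(k+\ell-1,1)}\right|$.
   Context: An $m\times n$ rational Dyck path is a lattice path from $(0,0)$ to $(m,n)$ using unit north steps $N$ and east steps $E$ that stays weakly above the line $y=nx/m$; $\mathcal{D}_{m,n}$ is the set of these paths. For $P\in\mathcal{D}_{m,n}$, let $u_i$ be the $x$-coordinate of the $i$-th north step of $P$ (bottom to top). Define $\mathrm{run}(P)=\min\{i\in\{1,\dots,n\}: i\notin\{u_1,\dots,u_n\}\}$. Let $\mathrm{ret}(P)$ be the number of north steps of $P$ from some $(i,j)$ to $(i,j+1)$ with $jm-in<n$. Set $\mathcal{D}_{m,n}^{(k,\ell)}=\{P\in\mathcal{D}_{m,n}:\mathrm{run}(P)=k,\ \mathrm{ret}(P)=\ell\}$. -}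

module Defs where

open import Data.Nat using (ℕ; zero; suc; _+_; _*_; _<ᵇ_; _≡ᵇ_)
open import Data.Bool using (Bool; true; false; _∧_; _∨_; not; if_then_else_)
open import Data.List using (List; []; _∷_; length; filter; map; _++_)
open import Relation.Nullary.Decidable using (Dec)
open import Data.Bool.Properties using (T?)
open import Data.Bool using (T)

-- A lattice path is a word in unit steps N (north, (0,1)) and E (east, (1,0)).
data Step : Set where
  N E : Step

Path : Set
Path = List Step

words : ℕ → List Path
words zero    = [] ∷ []
words (suc k) = map (N ∷_) (words k) ++ map (E ∷_) (words k)

countN countE : Path → ℕ
countN []      = 0
countN (N ∷ p) = suc (countN p)
countN (E ∷ p) = countN p
countE []      = 0
countE (N ∷ p) = countE p
countE (E ∷ p) = suc (countE p)

-- weakly above y = n x / m, checked at every lattice point visited,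
-- current position (x , y):  n * x ≤ m * y
aboveFrom : ℕ → ℕ → ℕ → ℕ → Path → Bool
aboveFrom m n x y []      = not (m * y <ᵇ n * x)
aboveFrom m n x y (N ∷ p) = not (m * y <ᵇ n * x) ∧ aboveFrom m n x (suc y) p
aboveFrom m n x y (E ∷ p) = not (m * y <ᵇ n * x) ∧ aboveFrom m n (suc x) y p

isDyck : ℕ → ℕ → Path → Bool
isDyck m n p = (countE p ≡ᵇ m) ∧ (countN p ≡ᵇ n) ∧ aboveFrom m n 0 0 p

-- the list u_1, …, u_n of x-coordinates of the north steps, bottom to top
northXsFrom : ℕ → Path → List ℕ
northXsFrom x []      = []
northXsFrom x (N ∷ p) = x ∷ northXsFrom x p
northXsFrom x (E ∷ p) = northXsFrom (suc x) p

elemᵇ : ℕ → List ℕ → Bool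
elemᵇ i []       = false
elemᵇ i (j ∷ js) = (i ≡ᵇ j) ∨ elemᵇ i js

-- least i ∈ {i₀, i₀+1, …, i₀+fuel-1} not in us; returns i₀ + fuel if none
firstMissing : ℕ → ℕ → List ℕ → ℕ
firstMissing zero       i us = i
firstMissing (suc fuel) i us = if elemᵇ i us then firstMissing fuel (suc i) us else i

-- run(P) = min { i ∈ {1,…,n} : i ∉ {u_1,…,u_n} }
-- (for P ∈ D_{m,n} with n ≥ 1 this set is nonempty since u_1 = 0)
run : ℕ → Path → ℕ
run n p = firstMissing n 1 (northXsFrom 0 p)

-- ret(P) = number of north steps from (i,j) to (i,j+1) with j m - i n < n,
-- i.e. (over ℕ) j * m < i * n + n
retFrom : ℕ → ℕ → ℕ → ℕ → Path → ℕ
retFrom m n i j []      = 0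
retFrom m n i j (N ∷ p) =
  (if j * m <ᵇ i * n + n then 1 else 0) + retFrom m n i (suc j) p
retFrom m n i j (E ∷ p) = retFrom m n (suc i) j p

ret : ℕ → ℕ → Path → ℕ
ret m n p = retFrom m n 0 0 p

-- the finite set D_{m,n}^{(k,ℓ)}, as an explicit duplicate-free list
-- (every path in D_{m,n} has exactly m + n steps)
D : ℕ → ℕ → ℕ → ℕ → List Path
D m n k ℓ = filter (λ p → T? (isDyck m n p ∧ (run n p ≡ᵇ k) ∧ (ret m n p ≡ᵇ ℓ)))
                   (words (m + n))

card : ℕ → ℕ → ℕ → ℕ → ℕ
card m n k ℓ = length (D m n k ℓ)

-- A path of D_{m,n} is recorded by the abscissae u₁ ≤ … ≤ uₙ of its north steps, the
-- i-th one leaving height i − 1; ret counts exactly the north steps that leave the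
-- rightmost lattice point ⌊hm/n⌋ of their row h.  As m ≥ 2n, such a step at height h ≥ 1
-- has abscissa ≥ 2h, while the staircase of north steps at abscissae 0, …, k − 1 that
-- makes run = k stays at abscissa ≤ height.  For ℓ ≥ 2, a path of D^{(k,ℓ)} is sent to
-- D^{(k+1,ℓ−1)} by inserting a north step at abscissa k right after the staircase,
-- moving the north steps at abscissa k + 1 to k, and deleting the first counted north
-- step above height 0; the steps in between are lifted by one row, which keeps them
-- uncounted.  The inverse deletes the first north step at abscissa k, moves the other
-- ones to k + 1, and inserts a counted step at the first row where the following step
-- would be counted.  Iterating this step ℓ − 1 times gives the claim.

module Submission where

open import Defs
open import Data.Nat using (ℕ; zero; suc; pred; _+_; _*_; _∸_; _≤_; _<_; _≤?_; _<?_; _≟_; z≤n; s≤s; _<ᵇ_; _≡ᵇ_; NonZero; ≢-nonZero⁻¹)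
open import Data.Nat.Properties
open import Data.Nat.DivMod using (_/_; _%_; m≡m%n+[m/n]*n; m%n<n; m*n/n≡m; m/n*n≤m; /-monoˡ-≤; m<n*o⇒m/o<n; 0/n≡0)
open import Data.Bool using (true; false; T; not; _∧_; _∨_)
open import Data.Bool.Properties using (T-∧; T?)
open import Data.List using (List; []; _∷_; length; map)
open import Data.List.Properties using (length-removeAt; length-map; ∷-injectiveʳ)
open import Data.List.Membership.Propositional using (_∈_; _∉_; _─_)
open import Data.List.Membership.Propositional.Properties using (∈-map⁺; ∈-map⁻; ∈-++⁺ˡ; ∈-++⁺ʳ; ∈-filter⁺; ∈-filter⁻)
open import Data.List.Membership.DecPropositional _≟_ using (_∈?_)
open import Data.List.Relation.Unary.Any using (here; there; index)
open import Data.List.Relation.Unary.All as All using (All; []; _∷_)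
open import Data.List.Relation.Unary.All.Properties as AllP using (All¬⇒¬Any)
open import Data.List.Relation.Unary.AllPairs as AllPairs using (_∷_)
open import Data.List.Relation.Unary.Unique.Propositional using (Unique)
import Data.List.Relation.Unary.Unique.Propositional.Properties as UniqueP
open import Data.List.Relation.Binary.Disjoint.Propositional using (Disjoint)
open import Data.Unit using (⊤; tt)
open import Data.Product using (Σ; _×_; _,_; proj₁; proj₂)
open import Data.Sum using (inj₁; inj₂)
open import Data.Empty using (⊥-elim)
open import Function.Base using (_∘_)
open import Function.Bundles using (_⇔_; mk⇔; Equivalence)
open import Function.Construct.Composition using (_⇔-∘_)
open import Relation.Nullary using (¬_; Dec; yes; no; does; proof; contradiction)
open import Relation.Nullary.Decidable using (dec-true; dec-false)
open import Relation.Nullary.Reflects using (Reflects; ofʸ; ofⁿ; ¬-reflects)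
open import Relation.Binary.PropositionalEquality

-- Counting by bijections

∈-─ : ∀ {A : Set} {x y : A} {ys} (x∈ys : x ∈ ys) → y ∈ ys → y ≢ x → y ∈ ys ─ x∈ys
∈-─ (here refl) (here refl) y≢x = ⊥-elim (y≢x refl)
∈-─ (here _)    (there y∈)  _   = y∈
∈-─ (there _)   (here refl) _   = here refl
∈-─ (there x∈)  (there y∈)  y≢x = there (∈-─ x∈ y∈ y≢x)

length-─ : ∀ {A : Set} {y : A} {ys} (y∈ys : y ∈ ys) → suc (length (ys ─ y∈ys)) ≡ length ys
length-─ {ys = y ∷ ys} y∈ys = cong suc (length-removeAt (y ∷ ys) (index y∈ys))

length-≤-of-injection : ∀ {A B : Set} (f : A → B) {xs : List A} {ys : List B} → Unique xs →
  (∀ {x} → x ∈ xs → f x ∈ ys) →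
  (∀ {x y} → x ∈ xs → y ∈ xs → f x ≡ f y → x ≡ y) →
  length xs ≤ length ys
length-≤-of-injection f {[]} _ _ _ = z≤n
length-≤-of-injection f {x ∷ xs} {ys} (x∉xs ∷ unique) into inj =
  subst (suc (length xs) ≤_) (length-─ (into (here refl)))
    (s≤s (length-≤-of-injection f unique into′ (λ x∈ y∈ → inj (there x∈) (there y∈))))
  where
  into′ : ∀ {y} → y ∈ xs → f y ∈ ys ─ into (here refl)
  into′ y∈xs = ∈-─ (into (here refl)) (into (there y∈xs))
    (λ fy≡fx → All.lookup x∉xs y∈xs (sym (inj (there y∈xs) (here refl) fy≡fx)))

length-≡-of-inverses : ∀ {A B : Set} (f : A → B) (g : B → A) {xs : List A} {ys : List B} →
  Unique xs → Unique ys →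
  (∀ {x} → x ∈ xs → f x ∈ ys) → (∀ {y} → y ∈ ys → g y ∈ xs) →
  (∀ {x} → x ∈ xs → g (f x) ≡ x) → (∀ {y} → y ∈ ys → f (g y) ≡ y) →
  length xs ≡ length ys
length-≡-of-inverses f g uxs uys f-into g-into g∘f f∘g =
  ≤-antisym (length-≤-of-injection f uxs f-into (cancel g g∘f))
            (length-≤-of-injection g uys g-into (cancel f f∘g))
  where
  cancel : ∀ {C D : Set} {f : C → D} {zs} (g : D → C) → (∀ {z} → z ∈ zs → g (f z) ≡ z) →
    ∀ {x y} → x ∈ zs → y ∈ zs → f x ≡ f y → x ≡ y
  cancel g inv x∈ y∈ fx≡fy = trans (sym (inv x∈)) (trans (cong g fx≡fy) (inv y∈))

words-unique : ∀ L → Unique (words L)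
words-unique zero    = All.[] ∷ AllPairs.[]
words-unique (suc L) = UniqueP.++⁺ (UniqueP.map⁺ ∷-injectiveʳ (words-unique L))
                                   (UniqueP.map⁺ ∷-injectiveʳ (words-unique L)) N-E-disjoint
  where
  N-E-disjoint : Disjoint (map (N ∷_) (words L)) (map (E ∷_) (words L))
  N-E-disjoint (N∈ , E∈) with ∈-map⁻ (N ∷_) N∈ | ∈-map⁻ (E ∷_) E∈
  ... | _ , _ , refl | _ , _ , ()

∈-words : ∀ p → p ∈ words (length p)
∈-words []      = here refl
∈-words (N ∷ p) = ∈-++⁺ˡ (∈-map⁺ (N ∷_) (∈-words p))
∈-words (E ∷ p) = ∈-++⁺ʳ (map (N ∷_) (words (length p))) (∈-map⁺ (E ∷_) (∈-words p))

Ascending : ℕ → List ℕ → Set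
Ascending q []       = ⊤
Ascending q (x ∷ xs) = q ≤ x × Ascending x xs

Ascending-all≥ : ∀ {q} xs → Ascending q xs → All (q ≤_) xs
Ascending-all≥ []       _            = []
Ascending-all≥ (x ∷ xs) (q≤x , asc) = q≤x ∷ All.map (≤-trans q≤x) (Ascending-all≥ xs asc)

Ascending-beyond : ∀ {q x} {xs} → q < x → Ascending x xs → All (q <_) (x ∷ xs)
Ascending-beyond {xs = xs} q<x asc = All.map (<-≤-trans q<x) (≤-refl ∷ Ascending-all≥ xs asc)

∈-tail : ∀ {j x : ℕ} {xs} → j ∈ x ∷ xs → j ≢ x → j ∈ xs
∈-tail (here j≡x)  j≢x = contradiction j≡x j≢x
∈-tail (there j∈) _   = j∈

elemᵇ-reflects : ∀ j us → Reflects (j ∈ us) (elemᵇ j us)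
elemᵇ-reflects j us = subst (Reflects (j ∈ us)) (sym (elemᵇ≡ us)) (proof (j ∈? us))
  where
  elemᵇ≡ : ∀ us → elemᵇ j us ≡ does (j ∈? us)
  elemᵇ≡ []       = refl
  elemᵇ≡ (x ∷ xs) = cong (_ ∨_) (elemᵇ≡ xs)

firstMissing-spec : ∀ fuel i us {K} → firstMissing fuel i us ≡ K →
  (∀ {j} → i ≤ j → j < K → j ∈ us) × (K < i + fuel → K ∉ us)
firstMissing-spec zero i us refl =
    (λ i≤j j<i → contradiction i≤j (<⇒≱ j<i))
  , (λ i<i+0 → contradiction (subst (i <_) (+-identityʳ i) i<i+0) (n≮n i))
firstMissing-spec (suc fuel) i us {K} eq with elemᵇ i us | elemᵇ-reflects i us
... | false | ofⁿ i∉us rewrite sym eq = (λ i≤j j<i → contradiction i≤j (<⇒≱ j<i)) , (λ _ → i∉us)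
... | true  | ofʸ i∈us with firstMissing-spec fuel (suc i) us eq
...   | below , at = below′ , (λ K< → at (subst (K <_) (+-suc i fuel) K<))
  where
  below′ : ∀ {j} → i ≤ j → j < K → j ∈ us
  below′ {j} i≤j j<K with i ≟ j
  ... | yes refl = i∈us
  ... | no  i≢j  = below (≤∧≢⇒< i≤j i≢j) j<K

firstMissing-intro : ∀ fuel i us {K} → i ≤ K → K ≤ i + fuel →
  (∀ {j} → i ≤ j → j < K → j ∈ us) → K ∉ us → firstMissing fuel i us ≡ K
firstMissing-intro zero i us i≤K K≤i+0 _ _ = ≤-antisym i≤K (subst (_ ≤_) (+-identityʳ i) K≤i+0)
firstMissing-intro (suc fuel) i us {K} i≤K K≤ below K∉us with elemᵇ i us | elemᵇ-reflects i us
... | false | ofⁿ i∉us with m≤n⇒m<n∨m≡n i≤K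
...   | inj₁ i<K = contradiction (below ≤-refl i<K) i∉us
...   | inj₂ i≡K = i≡K
firstMissing-intro (suc fuel) i us {K} i≤K K≤ below K∉us | true | ofʸ i∈us =
  firstMissing-intro fuel (suc i) us i<K (subst (K ≤_) (+-suc i fuel) K≤)
    (λ i<j → below (<⇒≤ i<j)) K∉us
  where
  i<K : i < K
  i<K = ≤∧≢⇒< i≤K (λ i≡K → K∉us (subst (_∈ us) i≡K i∈us))

length-bound-step : ∀ {p x} l → x ≤ suc p → suc x + l ≤ suc p + suc l
length-bound-step {p} l x≤p+1 = ≤-trans (+-monoˡ-≤ l (s≤s x≤p+1)) (≤-reflexive (sym (+-suc (suc p) l)))

-- Run K p xs: after an entry p, the ascending list xs takes every value p + 1, …, K − 1
-- and then skips K; thus run = K for a path coded by 0 ∷ xs.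
data Run (K : ℕ) : ℕ → List ℕ → Set where
  gap  : ∀ {p xs} → suc p ≡ K → All (K <_) xs → Run K p xs
  next : ∀ {p x xs} → p ≤ x → x ≤ suc p → x < K → Run K x xs → Run K p (x ∷ xs)

Run-intro : ∀ {K p} xs → Ascending p xs → (∀ {j} → p < j → j < K → j ∈ xs) →
  (K ≤ suc p + length xs → K ∉ xs) → p < K → Run K p xs
Run-intro {K} {p} [] _ below _ p<K with m≤n⇒m<n∨m≡n p<K
... | inj₁ p+1<K = contradiction (below ≤-refl p+1<K) λ ()
... | inj₂ p+1≡K = gap p+1≡K []
Run-intro {K} {p} (x ∷ xs) (p≤x , asc) below K∉ p<K with x ≤? suc p
... | yes x≤p+1 = next p≤x x≤p+1 x<K (Run-intro xs asc below′ K∉′ x<K)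
  where
  x<K : x < K
  x<K = ≤∧≢⇒< (≤-trans x≤p+1 p<K) λ x≡K →
    K∉ (subst (_≤ suc p + length (x ∷ xs)) x≡K (≤-trans x≤p+1 (m≤m+n (suc p) _))) (here (sym x≡K))
  below′ : ∀ {j} → x < j → j < K → j ∈ xs
  below′ x<j j<K = ∈-tail (below (<-≤-trans (s≤s p≤x) x<j) j<K) (>⇒≢ x<j)
  K∉′ : K ≤ suc x + length xs → K ∉ xs
  K∉′ K≤ K∈xs = K∉ (≤-trans K≤ (length-bound-step (length xs) x≤p+1)) (there K∈xs)
... | no  x≰p+1 with m≤n⇒m<n∨m≡n p<K
...   | inj₁ p+1<K =
  contradiction (All.lookup (Ascending-beyond (≰⇒> x≰p+1) asc) (below ≤-refl p+1<K)) (n≮n (suc p))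
...   | inj₂ refl  = gap refl (Ascending-beyond (≰⇒> x≰p+1) asc)

Run-∈ : ∀ {K p xs} → Run K p xs → ∀ {j} → p < j → j < K → j ∈ xs
Run-∈ (gap refl _) p<j j<K = contradiction p<j (≤⇒≯ (≤-pred j<K))
Run-∈ {xs = x ∷ _} (next _ x≤p+1 _ run) {j} p<j j<K with j ≟ x
... | yes refl = here refl
... | no  j≢x  = there (Run-∈ run (≤∧≢⇒< (≤-trans x≤p+1 p<j) (j≢x ∘ sym)) j<K)

Run-∉ : ∀ {K p xs} → Run K p xs → All (K ≢_) xs
Run-∉ (gap _ K<xs)        = All.map (<⇒≢) K<xs
Run-∉ (next _ _ x<K run)  = (>⇒≢ x<K) ∷ Run-∉ run

Run-all≥ : ∀ {K p xs} → Run K p xs → All (p ≤_) xs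
Run-all≥ (gap refl K<xs)       = All.map (≤-trans (n≤1+n _) ∘ <⇒≤) K<xs
Run-all≥ (next p≤x _ _ run)    = p≤x ∷ All.map (≤-trans p≤x) (Run-all≥ run)

Run-bound : ∀ {K p xs} → Run K p xs → K ≤ suc p + length xs
Run-bound {p = p} (gap refl _) = m≤m+n (suc p) _
Run-bound {xs = _ ∷ xs} (next _ x≤p+1 _ run) = ≤-trans (Run-bound run) (length-bound-step (length xs) x≤p+1)

Run-pos : ∀ {K p xs} → Run K p xs → p < K
Run-pos (gap p+1≡K _)     = ≤-reflexive p+1≡K
Run-pos (next p≤x _ _ run) = ≤-<-trans p≤x (Run-pos run)

module Swap (k : ℕ) where

  swap : ℕ → ℕ
  swap x with x ≟ k | x ≟ suc k
  ... | yes _ | _     = suc k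
  ... | no  _ | yes _ = k
  ... | no  _ | no  _ = x

  data SwapView : ℕ → ℕ → Set where
    at-k     : SwapView k (suc k)
    at-suc-k : SwapView (suc k) k
    fixed    : ∀ {x} → x ≢ k → x ≢ suc k → SwapView x x

  swap-view : ∀ x → SwapView x (swap x)
  swap-view x with x ≟ k | x ≟ suc k
  ... | yes refl | _        = at-k
  ... | no  _    | yes refl = at-suc-k
  ... | no  x≢k  | no x≢k+1 = fixed x≢k x≢k+1

  swap-k : swap k ≡ suc k
  swap-k with k ≟ k
  ... | yes _   = refl
  ... | no  k≢k = contradiction refl k≢k

  swap-suc-k : swap (suc k) ≡ k
  swap-suc-k with suc k ≟ k | suc k ≟ suc k
  ... | yes k+1≡k | _             = contradiction k+1≡k 1+n≢n
  ... | no  _     | yes _         = refl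
  ... | no  _     | no  k+1≢k+1   = contradiction refl k+1≢k+1

  swap-fixed : ∀ {x} → x ≢ k → x ≢ suc k → swap x ≡ x
  swap-fixed {x} x≢k x≢k+1 with x ≟ k | x ≟ suc k
  ... | yes x≡k | _         = contradiction x≡k x≢k
  ... | no  _   | yes x≡k+1 = contradiction x≡k+1 x≢k+1
  ... | no  _   | no  _     = refl

  swap-involutive : ∀ x → swap (swap x) ≡ x
  swap-involutive x with swap x | swap-view x
  ... | _ | at-k      = swap-suc-k
  ... | _ | at-suc-k  = swap-k
  ... | _ | fixed x≢k x≢k+1 = swap-fixed x≢k x≢k+1

  swap-mono : ∀ {x y} → x ≤ y → (x ≡ k → y ≢ suc k) → swap x ≤ swap y
  swap-mono {x} {y} x≤y ok with swap x | swap-view x | swap y | swap-view y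
  ... | _ | at-k        | _ | at-k          = ≤-refl
  ... | _ | at-k        | _ | at-suc-k      = contradiction refl (ok refl)
  ... | _ | at-k        | _ | fixed y≢k _   = ≤∧≢⇒< x≤y (y≢k ∘ sym)
  ... | _ | at-suc-k    | _ | at-k          = contradiction x≤y 1+n≰n
  ... | _ | at-suc-k    | _ | at-suc-k      = ≤-refl
  ... | _ | at-suc-k    | _ | fixed _ _     = ≤-trans (n≤1+n k) x≤y
  ... | _ | fixed _ _   | _ | at-k          = ≤-trans x≤y (n≤1+n k)
  ... | _ | fixed _ x≢k+1 | _ | at-suc-k    = ≤-pred (≤∧≢⇒< x≤y x≢k+1)
  ... | _ | fixed _ _   | _ | fixed _ _     = x≤y

  swap-≤ : ∀ {x} → k < x → swap x ≤ x
  swap-≤ {x} k<x with swap x | swap-view x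
  ... | _ | at-k      = contradiction k<x (n≮n k)
  ... | _ | at-suc-k  = n≤1+n k
  ... | _ | fixed _ _ = ≤-refl

  map-swap-involutive : ∀ zs → map swap (map swap zs) ≡ zs
  map-swap-involutive []       = refl
  map-swap-involutive (z ∷ zs) = cong₂ _∷_ (swap-involutive z) (map-swap-involutive zs)

  All-≢-map-swap : ∀ {w zs} → All (swap w ≢_) zs → All (w ≢_) (map swap zs)
  All-≢-map-swap = AllP.map⁺ ∘ All.map (λ {z} sw≢z w≡sz → sw≢z (trans (cong swap w≡sz) (swap-involutive z)))

  All-≥-map-swap : ∀ {zs} → All (k ≤_) zs → All (k ≤_) (map swap zs)
  All-≥-map-swap = AllP.map⁺ ∘ All.map k≤swap
    where
    k≤swap : ∀ {z} → k ≤ z → k ≤ swap z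
    k≤swap {z} k≤z with swap z | swap-view z
    ... | _ | at-k      = n≤1+n k
    ... | _ | at-suc-k  = ≤-refl
    ... | _ | fixed _ _ = k≤z

-- Rows, touching steps and admissible coordinate lists

module Coordinates (m n : ℕ) .{{_ : NonZero n}} where

  rightmost : ℕ → ℕ
  rightmost h = h * m / n

  rightmost-mono : ∀ {h h′} → h ≤ h′ → rightmost h ≤ rightmost h′
  rightmost-mono h≤h′ = /-monoˡ-≤ n (*-monoˡ-≤ m h≤h′)

  rightmost-suc : ∀ h → rightmost h ≤ rightmost (suc h)
  rightmost-suc h = rightmost-mono (n≤1+n h)

  rightmost-zero : rightmost 0 ≡ 0
  rightmost-zero = 0/n≡0 n

  ≤rightmost⇔ : ∀ {x h} → n * x ≤ m * h ⇔ x ≤ rightmost h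
  ≤rightmost⇔ {x} {h} = mk⇔ to from
    where
    to : n * x ≤ m * h → x ≤ rightmost h
    to nx≤mh = begin
      x         ≡⟨ m*n/n≡m x n ⟨
      x * n / n ≤⟨ /-monoˡ-≤ n (subst₂ _≤_ (*-comm n x) (*-comm m h) nx≤mh) ⟩
      h * m / n ∎
      where open ≤-Reasoning
    from : x ≤ rightmost h → n * x ≤ m * h
    from x≤r = begin
      n * x             ≤⟨ *-monoʳ-≤ n x≤r ⟩
      n * (h * m / n)   ≡⟨ *-comm n _ ⟩
      h * m / n * n     ≤⟨ m/n*n≤m (h * m) n ⟩
      h * m             ≡⟨ *-comm h m ⟩
      m * h             ∎
      where open ≤-Reasoning

  -- ret counts the north steps leaving the rightmost point of their row, see <⇔touches.
  Touches : ℕ → ℕ → Set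
  Touches h x = rightmost h ≤ x

  touches? : ∀ h x → Dec (Touches h x)
  touches? h x = rightmost h ≤? x

  <⇔touches : ∀ {h x} → h * m < x * n + n ⇔ Touches h x
  <⇔touches {h} {x} = mk⇔ to from
    where
    to : h * m < x * n + n → Touches h x
    to hm< = ≤-pred (m<n*o⇒m/o<n (subst (h * m <_) (+-comm (x * n) n) hm<))
    from : Touches h x → h * m < x * n + n
    from r≤x = begin-strict
      h * m                     ≡⟨ m≡m%n+[m/n]*n (h * m) n ⟩
      h * m % n + rightmost h * n <⟨ +-monoˡ-< _ (m%n<n (h * m) n) ⟩
      n + rightmost h * n       ≤⟨ +-monoʳ-≤ n (*-monoˡ-≤ n r≤x) ⟩
      n + x * n                 ≡⟨ +-comm n (x * n) ⟩
      x * n + n                 ∎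
      where open ≤-Reasoning

  -- The entries of xs are the abscissae of north steps leaving heights h, h + 1, …,
  -- and q is the abscissa of the north step before them.
  Admissible : ℕ → ℕ → List ℕ → Set
  Admissible h q []       = ⊤
  Admissible h q (x ∷ xs) = q ≤ x × x ≤ rightmost h × Admissible (suc h) x xs

  Admissible-all≥ : ∀ {h q xs} → Admissible h q xs → All (q ≤_) xs
  Admissible-all≥ {xs = []}    _               = []
  Admissible-all≥ {xs = _ ∷ _} (q≤x , _ , adm) = q≤x ∷ All.map (≤-trans q≤x) (Admissible-all≥ adm)

  Admissible-rebound : ∀ {h q q′ xs} → All (q′ ≤_) xs → Admissible h q xs → Admissible h q′ xs
  Admissible-rebound []           _               = tt
  Admissible-rebound (q′≤x ∷ _) (_ , x≤r , adm) = q′≤x , x≤r , adm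

  Admissible-weaken : ∀ {h q q′ xs} → q′ ≤ q → Admissible h q xs → Admissible h q′ xs
  Admissible-weaken q′≤q adm = Admissible-rebound (All.map (≤-trans q′≤q) (Admissible-all≥ adm)) adm

  retList : ℕ → List ℕ → ℕ
  retList h []       = 0
  retList h (x ∷ xs) with touches? h x
  ... | yes _ = suc (retList (suc h) xs)
  ... | no  _ = retList (suc h) xs

  retList-touch : ∀ {h x} xs → Touches h x → retList h (x ∷ xs) ≡ suc (retList (suc h) xs)
  retList-touch {h} {x} _ t with touches? h x
  ... | yes _ = refl
  ... | no ¬t = contradiction t ¬t

  retList-skip : ∀ {h x} xs → ¬ Touches h x → retList h (x ∷ xs) ≡ retList (suc h) xs
  retList-skip {h} {x} _ ¬t with touches? h x
  ... | yes t = contradiction t ¬t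
  ... | no  _ = refl

  ¬touches-suc : ∀ h {x} → ¬ Touches h x → ¬ Touches (suc h) x
  ¬touches-suc h ¬t t = ¬t (≤-trans (rightmost-suc h) t)

  insertTouch : ℕ → List ℕ → List ℕ
  insertTouch h []       = rightmost h ∷ []
  insertTouch h (y ∷ ys) with touches? h y
  ... | yes _ = rightmost h ∷ y ∷ ys
  ... | no  _ = y ∷ insertTouch (suc h) ys

  removeTouch : ℕ → List ℕ → List ℕ
  removeTouch h []       = []
  removeTouch h (x ∷ xs) with touches? h x
  ... | yes _ = xs
  ... | no  _ = x ∷ removeTouch (suc h) xs

  insertTouch-touch : ∀ {h y} ys → Touches h y → insertTouch h (y ∷ ys) ≡ rightmost h ∷ y ∷ ys
  insertTouch-touch {h} {y} _ t with touches? h y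
  ... | yes _ = refl
  ... | no ¬t = contradiction t ¬t

  insertTouch-skip : ∀ {h y} ys → ¬ Touches h y → insertTouch h (y ∷ ys) ≡ y ∷ insertTouch (suc h) ys
  insertTouch-skip {h} {y} _ ¬t with touches? h y
  ... | yes t = contradiction t ¬t
  ... | no  _ = refl

  removeTouch-touch : ∀ {h x} xs → Touches h x → removeTouch h (x ∷ xs) ≡ xs
  removeTouch-touch {h} {x} _ t with touches? h x
  ... | yes _ = refl
  ... | no ¬t = contradiction t ¬t

  removeTouch-skip : ∀ {h x} xs → ¬ Touches h x → removeTouch h (x ∷ xs) ≡ x ∷ removeTouch (suc h) xs
  removeTouch-skip {h} {x} _ ¬t with touches? h x
  ... | yes t = contradiction t ¬t
  ... | no  _ = refl

  removeTouch-insertTouch : ∀ h ys → removeTouch h (insertTouch h ys) ≡ ys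
  removeTouch-insertTouch h [] = removeTouch-touch [] ≤-refl
  removeTouch-insertTouch h (y ∷ ys) with touches? h y
  ... | yes _  = removeTouch-touch (y ∷ ys) ≤-refl
  ... | no  ¬t = trans (removeTouch-skip (insertTouch (suc h) ys) ¬t)
                       (cong (y ∷_) (removeTouch-insertTouch (suc h) ys))

  insertTouch-removeTouch : ∀ {h q} xs → Admissible h q xs → 0 < retList h xs →
    insertTouch h (removeTouch h xs) ≡ xs
  insertTouch-removeTouch []       _ ()
  insertTouch-removeTouch {h} (x ∷ xs) (_ , x≤r , adm) ret>0 with touches? h x
  ... | yes t = trans (insertTouch-before-touch xs adm) (cong (_∷ xs) (≤-antisym t x≤r))
    where
    insertTouch-before-touch : ∀ xs → Admissible (suc h) x xs → insertTouch h xs ≡ rightmost h ∷ xs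
    insertTouch-before-touch []       _         = refl
    insertTouch-before-touch (y ∷ ys) (x≤y , _) = insertTouch-touch ys (≤-trans t x≤y)
  ... | no ¬t = trans (insertTouch-skip (removeTouch (suc h) xs) ¬t)
                      (cong (x ∷_) (insertTouch-removeTouch xs adm ret>0))

  removeTouch-admissible : ∀ {h q} xs → Admissible h q xs → Admissible (suc h) q (removeTouch h xs)
  removeTouch-admissible []                           _ = tt
  removeTouch-admissible {h} (x ∷ xs) (q≤x , x≤r , adm) with touches? h x
  ... | yes _ = Admissible-weaken q≤x adm
  ... | no  _ = q≤x , ≤-trans x≤r (rightmost-suc h) , removeTouch-admissible xs adm

  insertTouch-admissible : ∀ {h q} ys → q ≤ rightmost h → Admissible (suc h) q ys →
    Admissible h q (insertTouch h ys)
  insertTouch-admissible []                             q≤r _ = q≤r , ≤-refl , tt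
  insertTouch-admissible {h} (y ∷ ys) q≤r adm@(q≤y , y≤r′ , adm′) with touches? h y
  ... | yes t  = q≤r , ≤-refl , Admissible-rebound (t ∷ All.map (≤-trans t) (Admissible-all≥ adm′)) adm
  ... | no  ¬t = q≤y , <⇒≤ (≰⇒> ¬t) , insertTouch-admissible ys y≤r′ adm′

  retList-removeTouch : ∀ h xs → retList (suc h) (removeTouch h xs) ≡ pred (retList h xs)
  retList-removeTouch h []       = refl
  retList-removeTouch h (x ∷ xs) with touches? h x
  ... | yes _  = refl
  ... | no  ¬t = trans (retList-skip (removeTouch (suc h) xs) (¬touches-suc h ¬t))
                       (retList-removeTouch (suc h) xs)

  retList-insertTouch : ∀ h ys → retList h (insertTouch h ys) ≡ suc (retList (suc h) ys)
  retList-insertTouch h []       = retList-touch [] ≤-refl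
  retList-insertTouch h (y ∷ ys) with touches? h y
  ... | yes t  = retList-touch (y ∷ ys) ≤-refl
  ... | no  ¬t = begin
    retList h (y ∷ insertTouch (suc h) ys)   ≡⟨ retList-skip (insertTouch (suc h) ys) ¬t ⟩
    retList (suc h) (insertTouch (suc h) ys) ≡⟨ retList-insertTouch (suc h) ys ⟩
    suc (retList (suc (suc h)) ys)           ≡⟨ cong suc (retList-skip ys (¬touches-suc h ¬t)) ⟨
    suc (retList (suc h) (y ∷ ys))           ∎
    where open ≡-Reasoning

  length-insertTouch : ∀ h ys → length (insertTouch h ys) ≡ suc (length ys)
  length-insertTouch h []       = refl
  length-insertTouch h (y ∷ ys) with touches? h y
  ... | yes _ = refl
  ... | no  _ = cong suc (length-insertTouch (suc h) ys)

  length-removeTouch : ∀ h xs → 0 < retList h xs → suc (length (removeTouch h xs)) ≡ length xs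
  length-removeTouch h []       ()
  length-removeTouch h (x ∷ xs) ret>0 with touches? h x
  ... | yes _ = refl
  ... | no  _ = cong suc (length-removeTouch (suc h) xs ret>0)

  All-removeTouch : ∀ {P : ℕ → Set} h {xs} → All P xs → All P (removeTouch h xs)
  All-removeTouch h {[]}     []         = []
  All-removeTouch h {x ∷ xs} (px ∷ pxs) with touches? h x
  ... | yes _ = pxs
  ... | no  _ = px ∷ All-removeTouch (suc h) pxs

  All-insertTouch : ∀ {P : ℕ → Set} h {ys} → (∀ {h′} → h ≤ h′ → P (rightmost h′)) → All P ys →
    All P (insertTouch h ys)
  All-insertTouch h {[]}     pr []         = pr ≤-refl ∷ []
  All-insertTouch h {y ∷ ys} pr (py ∷ pys) with touches? h y
  ... | yes _ = pr ≤-refl ∷ py ∷ pys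
  ... | no  _ = py ∷ All-insertTouch (suc h) (λ h<h′ → pr (<⇒≤ h<h′)) pys

  Admissible⇒Ascending : ∀ {h q} xs → Admissible h q xs → Ascending q xs
  Admissible⇒Ascending []       _               = tt
  Admissible⇒Ascending (x ∷ xs) (q≤x , _ , adm) = q≤x , Admissible⇒Ascending xs adm

  touches-origin : Touches 0 0
  touches-origin = ≤-reflexive rightmost-zero

-- Lattice paths as coordinate lists

T⇔ : ∀ {P : Set} {b} → Reflects P b → T b ⇔ P
T⇔ (ofʸ p)  = mk⇔ (λ _ → p) (λ _ → tt)
T⇔ (ofⁿ ¬p) = mk⇔ (λ ()) ¬p

T-∧₃ : ∀ a b c → T (a ∧ b ∧ c) ⇔ (T a × T b × T c)
T-∧₃ a b c = mk⇔
  (λ t → let (ta , tbc) = Equivalence.to (T-∧ {a}) t in ta , Equivalence.to (T-∧ {b}) tbc)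
  (λ (ta , tb , tc) → Equivalence.from (T-∧ {a}) (ta , Equivalence.from (T-∧ {b}) (tb , tc)))

module Coding (m n : ℕ) .{{_ : NonZero n}} where

  open Coordinates m n

  T-below : ∀ {h x} → T (not (m * h <ᵇ n * x)) ⇔ x ≤ rightmost h
  T-below {h} {x} = mk⇔ (to ≤rightmost⇔ ∘ ≮⇒≥ ∘ to ¬<) (from ¬< ∘ ≤⇒≯ ∘ from ≤rightmost⇔)
    where
    open Equivalence
    ¬< = T⇔ (¬-reflects (<ᵇ-reflects-< (m * h) (n * x)))

  northXs : Path → List ℕ
  northXs = northXsFrom 0

  east : ℕ → Path → Path
  east zero    p = p
  east (suc j) p = E ∷ east j p

  pathFrom : ℕ → List ℕ → Path
  pathFrom x []       = east (m ∸ x) []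
  pathFrom x (u ∷ us) = east (u ∸ x) (N ∷ pathFrom u us)

  toPath : List ℕ → Path
  toPath = pathFrom 0

  northXsFrom-east : ∀ j x p → northXsFrom x (east j p) ≡ northXsFrom (j + x) p
  northXsFrom-east zero    x p = refl
  northXsFrom-east (suc j) x p = trans (northXsFrom-east j (suc x) p) (cong (λ z → northXsFrom z p) (+-suc j x))

  northXsFrom-pathFrom : ∀ {h x} us → Admissible h x us → northXsFrom x (pathFrom x us) ≡ us
  northXsFrom-pathFrom {x = x} [] _ = northXsFrom-east (m ∸ x) x []
  northXsFrom-pathFrom {x = x} (u ∷ us) (x≤u , _ , adm) = begin
    northXsFrom x (east (u ∸ x) (N ∷ pathFrom u us))
      ≡⟨ northXsFrom-east (u ∸ x) x _ ⟩
    northXsFrom (u ∸ x + x) (N ∷ pathFrom u us)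
      ≡⟨ cong (λ z → northXsFrom z (N ∷ pathFrom u us)) (m∸n+n≡m x≤u) ⟩
    u ∷ northXsFrom u (pathFrom u us)
      ≡⟨ cong (u ∷_) (northXsFrom-pathFrom us adm) ⟩
    u ∷ us ∎
    where open ≡-Reasoning

  northXsFrom-≥ : ∀ x p → All (x ≤_) (northXsFrom x p)
  northXsFrom-≥ x []      = []
  northXsFrom-≥ x (N ∷ p) = ≤-refl ∷ northXsFrom-≥ x p
  northXsFrom-≥ x (E ∷ p) = All.map (≤-trans (n≤1+n x)) (northXsFrom-≥ (suc x) p)

  pathFrom-suc : ∀ x us → All (suc x ≤_) us → suc x ≤ m → pathFrom x us ≡ E ∷ pathFrom (suc x) us
  pathFrom-suc x []       _         x<m = cong (λ j → east j []) (+-∸-assoc 1 x<m)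
  pathFrom-suc x (u ∷ us) (x<u ∷ _) _   = cong (λ j → east j (N ∷ pathFrom u us)) (+-∸-assoc 1 x<u)

  pathFrom-northXsFrom : ∀ x p → x + countE p ≡ m → pathFrom x (northXsFrom x p) ≡ p
  pathFrom-northXsFrom x [] x≡m = cong (λ j → east j []) (trans (cong (_∸ x) (sym x≡m)) (m+n∸m≡n x 0))
  pathFrom-northXsFrom x (N ∷ p) e rewrite n∸n≡0 x = cong (N ∷_) (pathFrom-northXsFrom x p e)
  pathFrom-northXsFrom x (E ∷ p) e = begin
    pathFrom x (northXsFrom (suc x) p)           ≡⟨ pathFrom-suc x _ (northXsFrom-≥ (suc x) p) x<m ⟩
    E ∷ pathFrom (suc x) (northXsFrom (suc x) p) ≡⟨ cong (E ∷_) (pathFrom-northXsFrom (suc x) p e′) ⟩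
    E ∷ p                                        ∎
    where
    open ≡-Reasoning
    e′ : suc x + countE p ≡ m
    e′ = trans (sym (+-suc x (countE p))) e
    x<m : suc x ≤ m
    x<m = subst (suc x ≤_) e′ (m≤m+n (suc x) (countE p))

  admissible-northXsFrom : ∀ x y p → T (aboveFrom m n x y p) → Admissible y x (northXsFrom x p)
  admissible-northXsFrom x y []      _ = tt
  admissible-northXsFrom x y (N ∷ p) t =
    ≤-refl , Equivalence.to T-below below , admissible-northXsFrom x (suc y) p above
    where
    below = proj₁ (Equivalence.to T-∧ t)
    above = proj₂ (Equivalence.to T-∧ t)
  admissible-northXsFrom x y (E ∷ p) t =
    Admissible-weaken (n≤1+n x) (admissible-northXsFrom (suc x) y p (proj₂ (Equivalence.to T-∧ t)))

  length-northXsFrom : ∀ x p → length (northXsFrom x p) ≡ countN p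
  length-northXsFrom x []      = refl
  length-northXsFrom x (N ∷ p) = cong suc (length-northXsFrom x p)
  length-northXsFrom x (E ∷ p) = length-northXsFrom (suc x) p

  retFrom-northXsFrom : ∀ x y p → retFrom m n x y p ≡ retList y (northXsFrom x p)
  retFrom-northXsFrom x y []      = refl
  retFrom-northXsFrom x y (N ∷ p) with touches? y x
  ... | yes t  rewrite dec-true  (y * m <? x * n + n) (Equivalence.from (<⇔touches {y} {x}) t) =
    cong suc (retFrom-northXsFrom x (suc y) p)
  ... | no  ¬t rewrite dec-false (y * m <? x * n + n) (¬t ∘ Equivalence.to (<⇔touches {y} {x})) =
    retFrom-northXsFrom x (suc y) p
  retFrom-northXsFrom x y (E ∷ p) = retFrom-northXsFrom (suc x) y p

  rightmost-n : rightmost n ≡ m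
  rightmost-n = trans (cong (_/ n) (*-comm n m)) (m*n/n≡m m n)

  ≤m-below-top : ∀ {h x} l → x ≤ rightmost h → h + suc l ≡ n → x ≤ m
  ≤m-below-top {h} l x≤r h+l+1≡n =
    ≤-trans x≤r (subst (rightmost h ≤_) rightmost-n (rightmost-mono (subst (h ≤_) h+l+1≡n (m≤m+n h (suc l)))))

  row-step : ∀ {h} l → h + suc l ≡ n → suc h + l ≡ n
  row-step {h} l = trans (sym (+-suc h l))

  countN-east : ∀ j p → countN (east j p) ≡ countN p
  countN-east zero    p = refl
  countN-east (suc j) p = countN-east j p

  countE-east : ∀ j p → countE (east j p) ≡ j + countE p
  countE-east zero    p = refl
  countE-east (suc j) p = cong suc (countE-east j p)

  countN-pathFrom : ∀ x us → countN (pathFrom x us) ≡ length us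
  countN-pathFrom x []       = countN-east (m ∸ x) []
  countN-pathFrom x (u ∷ us) = trans (countN-east (u ∸ x) _) (cong suc (countN-pathFrom u us))

  countE-pathFrom : ∀ {h x} us → Admissible h x us → h + length us ≡ n → x ≤ m →
    x + countE (pathFrom x us) ≡ m
  countE-pathFrom {x = x} [] _ _ x≤m =
    trans (cong (x +_) (trans (countE-east (m ∸ x) []) (+-identityʳ _))) (m+[n∸m]≡n x≤m)
  countE-pathFrom {h} {x} (u ∷ us) (x≤u , u≤r , adm) h+l≡n x≤m = begin
    x + countE (east (u ∸ x) (N ∷ pathFrom u us))
      ≡⟨ cong (x +_) (countE-east (u ∸ x) _) ⟩
    x + (u ∸ x + countE (pathFrom u us))
      ≡⟨ +-assoc x (u ∸ x) _ ⟨
    x + (u ∸ x) + countE (pathFrom u us)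
      ≡⟨ cong (_+ countE (pathFrom u us)) (m+[n∸m]≡n x≤u) ⟩
    u + countE (pathFrom u us)
      ≡⟨ countE-pathFrom us adm (row-step _ h+l≡n) (≤m-below-top _ u≤r h+l≡n) ⟩
    m ∎
    where open ≡-Reasoning

  aboveFrom-east : ∀ {x u y} p → x ≤ u → u ≤ rightmost y → T (aboveFrom m n u y p) →
    T (aboveFrom m n x y (east (u ∸ x) p))
  aboveFrom-east {x} {u} {y} p x≤u u≤r t = go (u ∸ x) x (m∸n+n≡m x≤u)
    where
    go : ∀ j x → j + x ≡ u → T (aboveFrom m n x y (east j p))
    go zero    x refl  = t
    go (suc j) x j+x≡u = Equivalence.from T-∧
      ( Equivalence.from T-below (≤-trans (subst (x ≤_) j+x≡u (m≤n+m x (suc j))) u≤r)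
      , go j (suc x) (trans (+-suc j x) j+x≡u))

  aboveFrom-pathFrom : ∀ {h x} us → Admissible h x us → h + length us ≡ n → x ≤ m →
    T (aboveFrom m n x h (pathFrom x us))
  aboveFrom-pathFrom {h} [] _ h+0≡n x≤m = aboveFrom-east [] x≤m m≤r (Equivalence.from T-below m≤r)
    where
    m≤r : m ≤ rightmost h
    m≤r = ≤-reflexive (sym (trans (cong rightmost (trans (sym (+-identityʳ h)) h+0≡n)) rightmost-n))
  aboveFrom-pathFrom {h} (u ∷ us) (x≤u , u≤r , adm) h+l≡n _ =
    aboveFrom-east _ x≤u u≤r (Equivalence.from T-∧
      (Equivalence.from T-below u≤r , aboveFrom-pathFrom us adm (row-step _ h+l≡n) (≤m-below-top _ u≤r h+l≡n)))

  length≡countE+countN : ∀ p → length p ≡ countE p + countN p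
  length≡countE+countN []      = refl
  length≡countE+countN (N ∷ p) = trans (cong suc (length≡countE+countN p)) (sym (+-suc (countE p) (countN p)))
  length≡countE+countN (E ∷ p) = cong suc (length≡countE+countN p)

  isDyck⇔ : ∀ p → T (isDyck m n p) ⇔ (countE p ≡ m × countN p ≡ n × T (aboveFrom m n 0 0 p))
  isDyck⇔ p = mk⇔ (λ (e , c , a) → ≡ᵇ⇒≡ _ _ e , ≡ᵇ⇒≡ _ _ c , a)
                  (λ (e , c , a) → ≡⇒≡ᵇ _ _ e , ≡⇒≡ᵇ _ _ c , a)
    ⇔-∘ T-∧₃ (countE p ≡ᵇ m) (countN p ≡ᵇ n) _

  module _ {p : Path} (dyck : T (isDyck m n p)) where
    private
      countE≡m : countE p ≡ m
      countE≡m = proj₁ (Equivalence.to (isDyck⇔ p) dyck)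
      countN≡n : countN p ≡ n
      countN≡n = proj₁ (proj₂ (Equivalence.to (isDyck⇔ p) dyck))
      above : T (aboveFrom m n 0 0 p)
      above = proj₂ (proj₂ (Equivalence.to (isDyck⇔ p) dyck))

    isDyck⇒admissible : Admissible 0 0 (northXs p)
    isDyck⇒admissible = admissible-northXsFrom 0 0 p above

    isDyck⇒length : length (northXs p) ≡ n
    isDyck⇒length = trans (length-northXsFrom 0 p) countN≡n

    isDyck⇒length-path : length p ≡ m + n
    isDyck⇒length-path = trans (length≡countE+countN p) (cong₂ _+_ countE≡m countN≡n)

    toPath-northXs : toPath (northXs p) ≡ p
    toPath-northXs = pathFrom-northXsFrom 0 p countE≡m

  module _ {us : List ℕ} (adm : Admissible 0 0 us) (len : length us ≡ n) where

    isDyck-toPath : T (isDyck m n (toPath us))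
    isDyck-toPath = Equivalence.from (isDyck⇔ (toPath us))
      (countE-pathFrom us adm len z≤n , trans (countN-pathFrom 0 us) len , aboveFrom-pathFrom us adm len z≤n)

    northXs-toPath : northXs (toPath us) ≡ us
    northXs-toPath = northXsFrom-pathFrom us adm

  record DyckCode (k ℓ : ℕ) (us : List ℕ) : Set where
    field
      admissible : Admissible 0 0 us
      length≡n   : length us ≡ n
      run≡       : firstMissing n 1 us ≡ k
      ret≡       : retList 0 us ≡ ℓ

  module _ {k ℓ : ℕ} where
    private
      inD? : (p : Path) → Dec (T (isDyck m n p ∧ (run n p ≡ᵇ k) ∧ (ret m n p ≡ᵇ ℓ)))
      inD? p = T? (isDyck m n p ∧ (run n p ≡ᵇ k) ∧ (ret m n p ≡ᵇ ℓ))

      inD⇔ : ∀ p → T (isDyck m n p ∧ (run n p ≡ᵇ k) ∧ (ret m n p ≡ᵇ ℓ)) ⇔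
                   (T (isDyck m n p) × run n p ≡ k × ret m n p ≡ ℓ)
      inD⇔ p = mk⇔ (λ (d , r , s) → d , ≡ᵇ⇒≡ _ _ r , ≡ᵇ⇒≡ _ _ s)
                   (λ (d , r , s) → d , ≡⇒≡ᵇ _ _ r , ≡⇒≡ᵇ _ _ s)
               ⇔-∘ T-∧₃ (isDyck m n p) _ _

    ∈D⇒isDyck : ∀ {p} → p ∈ D m n k ℓ → T (isDyck m n p)
    ∈D⇒isDyck {p} p∈D = proj₁ (Equivalence.to (inD⇔ p) (proj₂ (∈-filter⁻ inD? {xs = words (m + n)} p∈D)))

    ∈D⇒DyckCode : ∀ {p} → p ∈ D m n k ℓ → DyckCode k ℓ (northXs p)
    ∈D⇒DyckCode {p} p∈D = record
      { admissible = isDyck⇒admissible {p} dyck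
      ; length≡n   = isDyck⇒length {p} dyck
      ; run≡       = run≡k
      ; ret≡       = trans (sym (retFrom-northXsFrom 0 0 p)) ret≡ℓ
      }
      where
      facts = Equivalence.to (inD⇔ p) (proj₂ (∈-filter⁻ inD? {xs = words (m + n)} p∈D))
      dyck = proj₁ facts
      run≡k = proj₁ (proj₂ facts)
      ret≡ℓ = proj₂ (proj₂ facts)

    DyckCode⇒∈D : ∀ {us} → DyckCode k ℓ us → toPath us ∈ D m n k ℓ
    DyckCode⇒∈D {us} c =
      ∈-filter⁺ inD? (subst (λ L → toPath us ∈ words L) (isDyck⇒length-path {toPath us} dyck) (∈-words (toPath us)))
      (Equivalence.from (inD⇔ (toPath us))
        ( dyck
        , trans (cong (firstMissing n 1) northXs≡) run≡
        , trans (retFrom-northXsFrom 0 0 (toPath us)) (trans (cong (retList 0) northXs≡) ret≡)))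
      where
      open DyckCode c
      dyck = isDyck-toPath admissible length≡n
      northXs≡ = northXs-toPath admissible length≡n

  card-≡-of-code-bijection : ∀ {k ℓ k′ ℓ′} (Φ Ψ : List ℕ → List ℕ) →
    (∀ {us} → DyckCode k ℓ us → DyckCode k′ ℓ′ (Φ us)) →
    (∀ {us} → DyckCode k′ ℓ′ us → DyckCode k ℓ (Ψ us)) →
    (∀ {us} → DyckCode k ℓ us → Ψ (Φ us) ≡ us) →
    (∀ {us} → DyckCode k′ ℓ′ us → Φ (Ψ us) ≡ us) →
    card m n k ℓ ≡ card m n k′ ℓ′
  card-≡-of-code-bijection Φ Ψ Φ-coded Ψ-coded Ψ∘Φ Φ∘Ψ =
    length-≡-of-inverses (lift Φ) (lift Ψ) (unique-D) (unique-D)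
      (DyckCode⇒∈D ∘ Φ-coded ∘ ∈D⇒DyckCode) (DyckCode⇒∈D ∘ Ψ-coded ∘ ∈D⇒DyckCode)
      (round-trip {F = Φ} {Ψ} Φ-coded Ψ∘Φ) (round-trip {F = Ψ} {Φ} Ψ-coded Φ∘Ψ)
    where
    lift : (List ℕ → List ℕ) → Path → Path
    lift F p = toPath (F (northXs p))
    unique-D : ∀ {k ℓ} → Unique (D m n k ℓ)
    unique-D = UniqueP.filter⁺ _ (words-unique (m + n))
    round-trip : ∀ {k ℓ k′ ℓ′} {F G : List ℕ → List ℕ} →
      (∀ {us} → DyckCode k ℓ us → DyckCode k′ ℓ′ (F us)) →
      (∀ {us} → DyckCode k ℓ us → G (F us) ≡ us) →
      ∀ {p} → p ∈ D m n k ℓ → lift G (lift F p) ≡ p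
    round-trip {F = F} {G} F-coded G∘F {p} p∈ = begin
      toPath (G (northXs (toPath (F (northXs p)))))
        ≡⟨ cong (toPath ∘ G) (northXs-toPath admissible length≡n) ⟩
      toPath (G (F (northXs p)))
        ≡⟨ cong toPath (G∘F (∈D⇒DyckCode p∈)) ⟩
      toPath (northXs p)
        ≡⟨ toPath-northXs {p} (∈D⇒isDyck p∈) ⟩
      p ∎
      where
      open ≡-Reasoning
      open DyckCode (F-coded (∈D⇒DyckCode p∈))

  -- 0 ∷ xs codes a path of D^{(K, 1 + ℓ)}, whose first north step is always counted by ret.
  record DyckTail (K ℓ : ℕ) (xs : List ℕ) : Set where
    field
      admissible : Admissible 1 0 xs
      length≡    : suc (length xs) ≡ n
      runShape   : Run K 0 xs
      ret≡       : retList 1 xs ≡ ℓ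

  DyckCode⇒DyckTail : ∀ {K ℓ us} → 1 ≤ K → DyckCode K (suc ℓ) us →
    Σ (List ℕ) λ xs → us ≡ 0 ∷ xs × DyckTail K ℓ xs
  DyckCode⇒DyckTail {us = []} _ c = contradiction (sym (DyckCode.length≡n c)) (≢-nonZero⁻¹ n)
  DyckCode⇒DyckTail {K} {ℓ} {u ∷ xs} 1≤K c with DyckCode.admissible c
  ... | _ , u≤r , adm with n≤0⇒n≡0 (subst (u ≤_) rightmost-zero u≤r)
  ...   | refl = xs , refl , record
    { admissible = adm
    ; length≡    = length≡n
    ; runShape   = Run-intro xs (Admissible⇒Ascending xs adm)
                     (λ 0<j j<K → ∈-tail (below 0<j j<K) (>⇒≢ 0<j))
                     (λ K≤ K∈xs → K∉ (s≤s (subst (K ≤_) length≡n K≤)) (there K∈xs)) 1≤K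
    ; ret≡       = suc-injective (trans (sym (retList-touch xs touches-origin)) ret≡)
    }
    where
    open DyckCode c
    below = proj₁ (firstMissing-spec n 1 (0 ∷ xs) run≡)
    K∉ = proj₂ (firstMissing-spec n 1 (0 ∷ xs) run≡)

  DyckTail⇒DyckCode : ∀ {K ℓ xs} → DyckTail K ℓ xs → DyckCode K (suc ℓ) (0 ∷ xs)
  DyckTail⇒DyckCode {K} {ℓ} {xs} t = record
    { admissible = z≤n , z≤n , admissible
    ; length≡n   = length≡
    ; run≡       = firstMissing-intro n 1 (0 ∷ xs) 0<K
                     (≤-trans (subst (K ≤_) length≡ (Run-bound runShape)) (n≤1+n n))
                     (λ 0<j j<K → there (Run-∈ runShape 0<j j<K))
                     (All¬⇒¬Any ((>⇒≢ 0<K) ∷ Run-∉ runShape))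
    ; ret≡       = trans (retList-touch xs touches-origin) (cong suc ret≡)
    }
    where
    open DyckTail t
    0<K : 0 < K
    0<K = Run-pos runShape

-- Trading a touching step for a longer run

module RunShift (m n : ℕ) .{{_ : NonZero n}} (two≤m/n : 2 ≤ m / n) where

  open Coordinates m n
  open Coding m n

  -- The only place where 2 ≤ m / n is used.
  double≤rightmost : ∀ h → h + h ≤ rightmost h
  double≤rightmost h = Equivalence.to ≤rightmost⇔ (begin
    n * (h + h)     ≡⟨ *-distribˡ-+ n h h ⟩
    n * h + n * h   ≡⟨ cong (n * h +_) (+-identityʳ (n * h)) ⟨
    2 * (n * h)     ≡⟨ *-assoc 2 n h ⟨
    2 * n * h       ≤⟨ *-monoˡ-≤ h two-n≤m ⟩
    m * h           ∎)
    where
    open ≤-Reasoning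
    two-n≤m : 2 * n ≤ m
    two-n≤m = ≤-trans (*-monoˡ-≤ n two≤m/n) (m/n*n≤m m n)

  height<rightmost : ∀ h → suc h < rightmost (suc h)
  height<rightmost h = ≤-trans (s≤s (m≤n+m (suc h) h)) (double≤rightmost (suc h))

  ≤height⇒<rightmost : ∀ {h h′ x} → x ≤ suc h → suc h ≤ h′ → x < rightmost h′
  ≤height⇒<rightmost {h} x≤h+1 h+1≤h′ = <-≤-trans (≤-<-trans x≤h+1 (height<rightmost h)) (rightmost-mono h+1≤h′)

  ≤height⇒¬touches : ∀ {h x} → x ≤ suc h → ¬ Touches (suc h) x
  ≤height⇒¬touches x≤h+1 = <⇒≱ (≤height⇒<rightmost x≤h+1 ≤-refl)

  module _ (k : ℕ) where

    open Swap k

    retList-map-swap : ∀ h zs → k ≤ h → retList (suc h) (map swap zs) ≡ retList (suc h) zs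
    retList-map-swap h []       _   = refl
    retList-map-swap h (z ∷ zs) k≤h with swap z | swap-view z
    ... | _ | at-k = begin
      retList (suc h) (suc k ∷ map swap zs) ≡⟨ retList-skip _ (≤height⇒¬touches (s≤s k≤h)) ⟩
      retList (suc (suc h)) (map swap zs)   ≡⟨ retList-map-swap (suc h) zs (m≤n⇒m≤1+n k≤h) ⟩
      retList (suc (suc h)) zs              ≡⟨ retList-skip _ (≤height⇒¬touches (m≤n⇒m≤1+n k≤h)) ⟨
      retList (suc h) (k ∷ zs)              ∎
      where open ≡-Reasoning
    ... | _ | at-suc-k = begin
      retList (suc h) (k ∷ map swap zs)     ≡⟨ retList-skip _ (≤height⇒¬touches (m≤n⇒m≤1+n k≤h)) ⟩
      retList (suc (suc h)) (map swap zs)   ≡⟨ retList-map-swap (suc h) zs (m≤n⇒m≤1+n k≤h) ⟩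
      retList (suc (suc h)) zs              ≡⟨ retList-skip _ (≤height⇒¬touches (s≤s k≤h)) ⟨
      retList (suc h) (suc k ∷ zs)          ∎
      where open ≡-Reasoning
    ... | _ | fixed _ _ with touches? (suc h) z
    ...   | yes _ = cong suc (retList-map-swap (suc h) zs (m≤n⇒m≤1+n k≤h))
    ...   | no  _ = retList-map-swap (suc h) zs (m≤n⇒m≤1+n k≤h)

    Admissible-map-swap-above : ∀ {h q} zs → k < q → Admissible h q zs → Admissible h (swap q) (map swap zs)
    Admissible-map-swap-above []       _   _                 = tt
    Admissible-map-swap-above (z ∷ zs) k<q (q≤z , z≤r , adm) =
      swap-mono q≤z (λ q≡k → contradiction q≡k (>⇒≢ k<q)) , ≤-trans (swap-≤ k<z) z≤r ,
      Admissible-map-swap-above zs k<z adm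
      where
      k<z = <-≤-trans k<q q≤z

    Admissible-map-swap-avoiding : ∀ {h q} zs → k ≤ h → All (suc k ≢_) zs →
      Admissible (suc h) q zs → Admissible (suc h) (swap q) (map swap zs)
    Admissible-map-swap-avoiding []       _   _                _                 = tt
    Admissible-map-swap-avoiding {h} (z ∷ zs) k≤h (k+1≢z ∷ k+1∉zs) (q≤z , z≤r , adm) =
      swap-mono q≤z (λ _ → k+1≢z ∘ sym) , swap-z≤r ,
      Admissible-map-swap-avoiding zs (m≤n⇒m≤1+n k≤h) k+1∉zs adm
      where
      swap-z≤r : swap z ≤ rightmost (suc h)
      swap-z≤r with swap z | swap-view z
      ... | _ | at-k      = ≤-trans (s≤s k≤h) (<⇒≤ (height<rightmost h))
      ... | _ | at-suc-k  = contradiction refl k+1≢z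
      ... | _ | fixed _ _ = z≤r

    extendRun : ℕ → List ℕ → List ℕ
    extendRun h []       = k ∷ []
    extendRun h (x ∷ xs) with x <? k
    ... | yes _ = x ∷ extendRun (suc h) xs
    ... | no  _ = k ∷ map swap (removeTouch h (x ∷ xs))

    retractRun : ℕ → List ℕ → List ℕ
    retractRun h []       = []
    retractRun h (y ∷ ys) with y <? k
    ... | yes _ = y ∷ retractRun (suc h) ys
    ... | no  _ = insertTouch h (map swap ys)

    extendRun-< : ∀ {h x} xs → x < k → extendRun h (x ∷ xs) ≡ x ∷ extendRun (suc h) xs
    extendRun-< {x = x} _ x<k with x <? k
    ... | yes _   = refl
    ... | no  x≮k = contradiction x<k x≮k

    extendRun-≥ : ∀ {h} xs → All (k ≤_) xs → extendRun h xs ≡ k ∷ map swap (removeTouch h xs)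
    extendRun-≥ []       _         = refl
    extendRun-≥ (x ∷ xs) (k≤x ∷ _) with x <? k
    ... | yes x<k = contradiction k≤x (<⇒≱ x<k)
    ... | no  _   = refl

    retractRun-< : ∀ {h y} ys → y < k → retractRun h (y ∷ ys) ≡ y ∷ retractRun (suc h) ys
    retractRun-< {y = y} _ y<k with y <? k
    ... | yes _   = refl
    ... | no  y≮k = contradiction y<k y≮k

    retractRun-k : ∀ {h} ys → retractRun h (k ∷ ys) ≡ insertTouch h (map swap ys)
    retractRun-k _ with k <? k
    ... | yes k<k = contradiction k<k (n≮n k)
    ... | no  _   = refl

    extendRun-admissible : ∀ {h p} xs → Run k p xs → p ≤ h → Admissible (suc h) p xs →
      Admissible (suc h) p (extendRun (suc h) xs)
    extendRun-admissible {h} {p} xs (gap p+1≡k k<xs) p≤h adm rewrite extendRun-≥ {suc h} xs (All.map <⇒≤ k<xs) =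
      ≤-trans (n≤1+n p) (≤-reflexive p+1≡k) ,
      ≤-trans (≤-reflexive (sym p+1≡k)) (≤-trans (s≤s p≤h) (<⇒≤ (height<rightmost h))) ,
      subst (λ q → Admissible (suc (suc h)) q (map swap (removeTouch (suc h) xs))) swap-suc-k
        (Admissible-map-swap-above _ ≤-refl (removeTouch-admissible xs (Admissible-rebound k<xs adm)))
    extendRun-admissible {h} (x ∷ xs) (next p≤x x≤p+1 x<k run) p≤h (_ , x≤r , adm)
      rewrite extendRun-< {suc h} xs x<k =
      p≤x , x≤r , extendRun-admissible xs run (≤-trans x≤p+1 (s≤s p≤h)) adm

    retList-extendRun : ∀ {h p} xs → Run k p xs → p ≤ h →
      retList (suc h) (extendRun (suc h) xs) ≡ pred (retList (suc h) xs)
    retList-extendRun {h} {p} xs (gap p+1≡k k<xs) p≤h = begin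
      retList (suc h) (extendRun (suc h) xs)
        ≡⟨ cong (retList (suc h)) (extendRun-≥ xs (All.map <⇒≤ k<xs)) ⟩
      retList (suc h) (k ∷ map swap (removeTouch (suc h) xs))
        ≡⟨ retList-skip _ (≤height⇒¬touches k≤h+1) ⟩
      retList (suc (suc h)) (map swap (removeTouch (suc h) xs))
        ≡⟨ retList-map-swap (suc h) (removeTouch (suc h) xs) k≤h+1 ⟩
      retList (suc (suc h)) (removeTouch (suc h) xs)
        ≡⟨ retList-removeTouch (suc h) xs ⟩
      pred (retList (suc h) xs) ∎
      where
      open ≡-Reasoning
      k≤h+1 : k ≤ suc h
      k≤h+1 = ≤-trans (≤-reflexive (sym p+1≡k)) (s≤s p≤h)
    retList-extendRun {h} (x ∷ xs) (next _ x≤p+1 x<k run) p≤h = begin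
      retList (suc h) (extendRun (suc h) (x ∷ xs))
        ≡⟨ cong (retList (suc h)) (extendRun-< xs x<k) ⟩
      retList (suc h) (x ∷ extendRun (suc (suc h)) xs)
        ≡⟨ retList-skip _ (≤height⇒¬touches x≤h+1) ⟩
      retList (suc (suc h)) (extendRun (suc (suc h)) xs)
        ≡⟨ retList-extendRun xs run x≤h+1 ⟩
      pred (retList (suc (suc h)) xs)
        ≡⟨ cong pred (retList-skip _ (≤height⇒¬touches x≤h+1)) ⟨
      pred (retList (suc h) (x ∷ xs)) ∎
      where
      open ≡-Reasoning
      x≤h+1 : x ≤ suc h
      x≤h+1 = ≤-trans x≤p+1 (s≤s p≤h)

    retractRun-extendRun : ∀ {h p} xs → Run k p xs → p ≤ h → Admissible (suc h) p xs →
      0 < retList (suc h) xs → retractRun (suc h) (extendRun (suc h) xs) ≡ xs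
    retractRun-extendRun {h} xs (gap _ k<xs) _ adm ret>0 = begin
      retractRun (suc h) (extendRun (suc h) xs)
        ≡⟨ cong (retractRun (suc h)) (extendRun-≥ xs (All.map <⇒≤ k<xs)) ⟩
      retractRun (suc h) (k ∷ map swap (removeTouch (suc h) xs))
        ≡⟨ retractRun-k _ ⟩
      insertTouch (suc h) (map swap (map swap (removeTouch (suc h) xs)))
        ≡⟨ cong (insertTouch (suc h)) (map-swap-involutive (removeTouch (suc h) xs)) ⟩
      insertTouch (suc h) (removeTouch (suc h) xs)
        ≡⟨ insertTouch-removeTouch xs adm ret>0 ⟩
      xs ∎
      where open ≡-Reasoning
    retractRun-extendRun {h} (x ∷ xs) (next _ x≤p+1 x<k run) p≤h (_ , _ , adm) ret>0 = begin
      retractRun (suc h) (extendRun (suc h) (x ∷ xs))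
        ≡⟨ cong (retractRun (suc h)) (extendRun-< xs x<k) ⟩
      retractRun (suc h) (x ∷ extendRun (suc (suc h)) xs)
        ≡⟨ retractRun-< _ x<k ⟩
      x ∷ retractRun (suc (suc h)) (extendRun (suc (suc h)) xs)
        ≡⟨ cong (x ∷_) (retractRun-extendRun xs run x≤h+1 adm ret>0′) ⟩
      x ∷ xs ∎
      where
      open ≡-Reasoning
      x≤h+1 : x ≤ suc h
      x≤h+1 = ≤-trans x≤p+1 (s≤s p≤h)
      ret>0′ : 0 < retList (suc (suc h)) xs
      ret>0′ = subst (0 <_) (retList-skip xs (≤height⇒¬touches x≤h+1)) ret>0

    length-extendRun : ∀ {h p} xs → Run k p xs → p ≤ h → 0 < retList (suc h) xs →
      length (extendRun (suc h) xs) ≡ length xs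
    length-extendRun {h} xs (gap _ k<xs) _ ret>0 = begin
      length (extendRun (suc h) xs)
        ≡⟨ cong length (extendRun-≥ xs (All.map <⇒≤ k<xs)) ⟩
      suc (length (map swap (removeTouch (suc h) xs)))
        ≡⟨ cong suc (length-map swap (removeTouch (suc h) xs)) ⟩
      suc (length (removeTouch (suc h) xs))
        ≡⟨ length-removeTouch (suc h) xs ret>0 ⟩
      length xs ∎
      where open ≡-Reasoning
    length-extendRun {h} (x ∷ xs) (next _ x≤p+1 x<k run) p≤h ret>0 =
      trans (cong length (extendRun-< xs x<k)) (cong suc (length-extendRun xs run x≤h+1 ret>0′))
      where
      x≤h+1 : x ≤ suc h
      x≤h+1 = ≤-trans x≤p+1 (s≤s p≤h)
      ret>0′ : 0 < retList (suc (suc h)) xs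
      ret>0′ = subst (0 <_) (retList-skip xs (≤height⇒¬touches x≤h+1)) ret>0

    ∈-extendRun : ∀ {h p j} xs → Run k p xs → j < k → j ∈ xs → j ∈ extendRun h xs
    ∈-extendRun xs (gap _ k<xs) j<k j∈xs = contradiction (All.lookup k<xs j∈xs) (<⇒≯ j<k)
    ∈-extendRun {h} (x ∷ xs) (next _ _ x<k run) j<k j∈ rewrite extendRun-< {h} xs x<k with j∈
    ... | here j≡x   = here j≡x
    ... | there j∈xs = there (∈-extendRun xs run j<k j∈xs)

    k∈extendRun : ∀ h xs → k ∈ extendRun h xs
    k∈extendRun h []       = here refl
    k∈extendRun h (x ∷ xs) with x <? k
    ... | yes _ = there (k∈extendRun (suc h) xs)
    ... | no  _ = here refl

    extendRun-avoids-suc-k : ∀ h xs → All (k ≢_) xs → All (suc k ≢_) (extendRun h xs)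
    extendRun-avoids-suc-k h []       _   = 1+n≢n ∷ []
    extendRun-avoids-suc-k h (x ∷ xs) k∉ with x <? k
    ... | yes x<k = >⇒≢ (m≤n⇒m≤1+n x<k) ∷ extendRun-avoids-suc-k (suc h) xs (All.tail k∉)
    ... | no  _   = 1+n≢n ∷ All-≢-map-swap (subst (λ w → All (w ≢_) _) (sym swap-suc-k) (All-removeTouch h k∉))

    retractRun-admissible : ∀ {h p} ys → Run (suc k) p ys → p < k → p ≤ h → Admissible (suc h) p ys →
      Admissible (suc h) p (retractRun (suc h) ys)
    retractRun-admissible ys (gap p+1≡k+1 _) p<k _ _ = contradiction (suc-injective p+1≡k+1) (<⇒≢ p<k)
    retractRun-admissible {h} {p} (y ∷ ys) (next p≤y y≤p+1 y≤k run) p<k p≤h (_ , y≤r , adm)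
      with m≤n⇒m<n∨m≡n (≤-pred y≤k)
    ... | inj₁ y<k rewrite retractRun-< {suc h} ys y<k =
      p≤y , y≤r , retractRun-admissible ys run y<k (≤-trans y≤p+1 (s≤s p≤h)) adm
    ... | inj₂ refl rewrite retractRun-k {suc h} ys =
      insertTouch-admissible (map swap ys) p≤r
        (Admissible-weaken p≤swap-k (Admissible-map-swap-avoiding ys (≤-trans y≤p+1 (s≤s p≤h)) (Run-∉ run) adm))
      where
      p≤r : p ≤ rightmost (suc h)
      p≤r = ≤-trans (m≤n⇒m≤1+n p≤h) (<⇒≤ (height<rightmost h))
      p≤swap-k : p ≤ swap k
      p≤swap-k = ≤-trans (m≤n⇒m≤1+n (<⇒≤ p<k)) (≤-reflexive (sym swap-k))

    retList-retractRun : ∀ {h p} ys → Run (suc k) p ys → p < k → p ≤ h →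
      retList (suc h) (retractRun (suc h) ys) ≡ suc (retList (suc h) ys)
    retList-retractRun ys (gap p+1≡k+1 _) p<k _ = contradiction (suc-injective p+1≡k+1) (<⇒≢ p<k)
    retList-retractRun {h} (y ∷ ys) (next _ y≤p+1 y≤k run) p<k p≤h with m≤n⇒m<n∨m≡n (≤-pred y≤k)
    ... | inj₁ y<k = begin
      retList (suc h) (retractRun (suc h) (y ∷ ys))
        ≡⟨ cong (retList (suc h)) (retractRun-< ys y<k) ⟩
      retList (suc h) (y ∷ retractRun (suc (suc h)) ys)
        ≡⟨ retList-skip _ (≤height⇒¬touches y≤h+1) ⟩
      retList (suc (suc h)) (retractRun (suc (suc h)) ys)
        ≡⟨ retList-retractRun ys run y<k y≤h+1 ⟩
      suc (retList (suc (suc h)) ys)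
        ≡⟨ cong suc (retList-skip ys (≤height⇒¬touches y≤h+1)) ⟨
      suc (retList (suc h) (y ∷ ys)) ∎
      where
      open ≡-Reasoning
      y≤h+1 = ≤-trans y≤p+1 (s≤s p≤h)
    ... | inj₂ refl = begin
      retList (suc h) (retractRun (suc h) (k ∷ ys))
        ≡⟨ cong (retList (suc h)) (retractRun-k ys) ⟩
      retList (suc h) (insertTouch (suc h) (map swap ys))
        ≡⟨ retList-insertTouch (suc h) (map swap ys) ⟩
      suc (retList (suc (suc h)) (map swap ys))
        ≡⟨ cong suc (retList-map-swap (suc h) ys k≤h+1) ⟩
      suc (retList (suc (suc h)) ys)
        ≡⟨ cong suc (retList-skip ys (≤height⇒¬touches k≤h+1)) ⟨
      suc (retList (suc h) (k ∷ ys)) ∎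
      where
      open ≡-Reasoning
      k≤h+1 = ≤-trans y≤p+1 (s≤s p≤h)

    extendRun-retractRun : ∀ {h p} ys → Run (suc k) p ys → p < k → p ≤ h →
      extendRun (suc h) (retractRun (suc h) ys) ≡ ys
    extendRun-retractRun ys (gap p+1≡k+1 _) p<k _ = contradiction (suc-injective p+1≡k+1) (<⇒≢ p<k)
    extendRun-retractRun {h} (y ∷ ys) (next _ y≤p+1 y≤k run) p<k p≤h with m≤n⇒m<n∨m≡n (≤-pred y≤k)
    ... | inj₁ y<k = begin
      extendRun (suc h) (retractRun (suc h) (y ∷ ys))
        ≡⟨ cong (extendRun (suc h)) (retractRun-< ys y<k) ⟩
      extendRun (suc h) (y ∷ retractRun (suc (suc h)) ys)
        ≡⟨ extendRun-< _ y<k ⟩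
      y ∷ extendRun (suc (suc h)) (retractRun (suc (suc h)) ys)
        ≡⟨ cong (y ∷_) (extendRun-retractRun ys run y<k (≤-trans y≤p+1 (s≤s p≤h))) ⟩
      y ∷ ys ∎
      where open ≡-Reasoning
    ... | inj₂ refl = begin
      extendRun (suc h) (retractRun (suc h) (k ∷ ys))
        ≡⟨ cong (extendRun (suc h)) (retractRun-k ys) ⟩
      extendRun (suc h) (insertTouch (suc h) (map swap ys))
        ≡⟨ extendRun-≥ _ (All-insertTouch (suc h) k≤rightmost (All-≥-map-swap (Run-all≥ run))) ⟩
      k ∷ map swap (removeTouch (suc h) (insertTouch (suc h) (map swap ys)))
        ≡⟨ cong (λ zs → k ∷ map swap zs) (removeTouch-insertTouch (suc h) (map swap ys)) ⟩
      k ∷ map swap (map swap ys)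
        ≡⟨ cong (k ∷_) (map-swap-involutive ys) ⟩
      k ∷ ys ∎
      where
      open ≡-Reasoning
      k≤rightmost : ∀ {h′} → suc h ≤ h′ → k ≤ rightmost h′
      k≤rightmost = <⇒≤ ∘ ≤height⇒<rightmost (≤-trans y≤p+1 (s≤s p≤h))

    length-retractRun : ∀ {h p} ys → Run (suc k) p ys → p < k → length (retractRun h ys) ≡ length ys
    length-retractRun ys (gap p+1≡k+1 _) p<k = contradiction (suc-injective p+1≡k+1) (<⇒≢ p<k)
    length-retractRun {h} (y ∷ ys) (next _ _ y≤k run) p<k with m≤n⇒m<n∨m≡n (≤-pred y≤k)
    ... | inj₁ y<k  = trans (cong length (retractRun-< ys y<k)) (cong suc (length-retractRun ys run y<k))
    ... | inj₂ refl = trans (cong length (retractRun-k ys))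
                            (trans (length-insertTouch h (map swap ys)) (cong suc (length-map swap ys)))

    ∈-retractRun : ∀ {h p j} ys → Run (suc k) p ys → j < k → j ∈ ys → j ∈ retractRun h ys
    ∈-retractRun ys (gap _ k+1<ys) j<k j∈ys = contradiction (All.lookup k+1<ys j∈ys) (<⇒≯ (m≤n⇒m≤1+n j<k))
    ∈-retractRun {h} (y ∷ ys) (next _ _ y≤k run) j<k j∈ with m≤n⇒m<n∨m≡n (≤-pred y≤k)
    ... | inj₁ y<k rewrite retractRun-< {h} ys y<k with j∈
    ...   | here j≡y   = here j≡y
    ...   | there j∈ys = there (∈-retractRun ys run j<k j∈ys)
    ∈-retractRun (y ∷ ys) (next _ _ _ run) j<k j∈ | inj₂ refl with j∈
    ...   | here j≡k   = contradiction j≡k (<⇒≢ j<k)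
    ...   | there j∈ys = contradiction (All.lookup (Run-all≥ run) j∈ys) (<⇒≱ j<k)

    retractRun-avoids-k : ∀ {h p} ys → Run (suc k) p ys → p < k → p ≤ h → All (k ≢_) (retractRun (suc h) ys)
    retractRun-avoids-k ys (gap p+1≡k+1 _) p<k _ = contradiction (suc-injective p+1≡k+1) (<⇒≢ p<k)
    retractRun-avoids-k {h} (y ∷ ys) (next _ y≤p+1 y≤k run) p<k p≤h with m≤n⇒m<n∨m≡n (≤-pred y≤k)
    ... | inj₁ y<k rewrite retractRun-< {suc h} ys y<k =
      >⇒≢ y<k ∷ retractRun-avoids-k ys run y<k (≤-trans y≤p+1 (s≤s p≤h))
    ... | inj₂ refl rewrite retractRun-k {suc h} ys =
      All-insertTouch (suc h) k≢rightmost (All-≢-map-swap (subst (λ w → All (w ≢_) ys) (sym swap-k) (Run-∉ run)))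
      where
      k≢rightmost : ∀ {h′} → suc h ≤ h′ → k ≢ rightmost h′
      k≢rightmost = <⇒≢ ∘ ≤height⇒<rightmost (≤-trans y≤p+1 (s≤s p≤h))

    extendRun-DyckTail : ∀ {r xs} → DyckTail k (suc r) xs → DyckTail (suc k) r (extendRun 1 xs)
    extendRun-DyckTail {r} {xs} t = record
      { admissible = admissible′
      ; length≡    = trans (cong suc (length-extendRun xs runShape z≤n ret>0)) length≡
      ; runShape   = Run-intro _ (Admissible⇒Ascending _ admissible′) below
                       (λ _ → All¬⇒¬Any (extendRun-avoids-suc-k 1 xs (Run-∉ runShape))) (s≤s z≤n)
      ; ret≡       = trans (retList-extendRun xs runShape z≤n) (cong pred ret≡)
      }
      where
      open DyckTail t
      admissible′ = extendRun-admissible xs runShape z≤n admissible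
      ret>0 : 0 < retList 1 xs
      ret>0 = subst (0 <_) (sym ret≡) (s≤s z≤n)
      below : ∀ {j} → 0 < j → j < suc k → j ∈ extendRun 1 xs
      below 0<j j≤k with m≤n⇒m<n∨m≡n (≤-pred j≤k)
      ... | inj₁ j<k  = ∈-extendRun xs runShape j<k (Run-∈ runShape 0<j j<k)
      ... | inj₂ refl = k∈extendRun 1 xs

    retractRun-DyckTail : ∀ {r ys} → 1 ≤ k → DyckTail (suc k) r ys → DyckTail k (suc r) (retractRun 1 ys)
    retractRun-DyckTail {r} {ys} 1≤k t = record
      { admissible = admissible′
      ; length≡    = trans (cong suc (length-retractRun ys runShape 1≤k)) length≡
      ; runShape   = Run-intro _ (Admissible⇒Ascending _ admissible′)
                       (λ 0<j j<k → ∈-retractRun ys runShape j<k (Run-∈ runShape 0<j (m≤n⇒m≤1+n j<k)))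
                       (λ _ → All¬⇒¬Any (retractRun-avoids-k ys runShape 1≤k z≤n)) 1≤k
      ; ret≡       = trans (retList-retractRun ys runShape 1≤k z≤n) (cong suc ret≡)
      }
      where
      open DyckTail t
      admissible′ = retractRun-admissible ys runShape 1≤k z≤n admissible

    extend retract : List ℕ → List ℕ
    extend []       = []
    extend (u ∷ us) = u ∷ extendRun 1 us
    retract []       = []
    retract (u ∷ us) = u ∷ retractRun 1 us

    card-step : ∀ r → 1 ≤ k → card m n k (suc (suc r)) ≡ card m n (suc k) (suc r)
    card-step r 1≤k =
      card-≡-of-code-bijection extend retract extend-DyckCode retract-DyckCode retract-extend extend-retract
      where
      extend-DyckCode : ∀ {us} → DyckCode k (suc (suc r)) us → DyckCode (suc k) (suc r) (extend us)
      extend-DyckCode c with DyckCode⇒DyckTail 1≤k c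
      ... | _ , refl , t = DyckTail⇒DyckCode (extendRun-DyckTail t)
      retract-DyckCode : ∀ {us} → DyckCode (suc k) (suc r) us → DyckCode k (suc (suc r)) (retract us)
      retract-DyckCode c with DyckCode⇒DyckTail (s≤s z≤n) c
      ... | _ , refl , t = DyckTail⇒DyckCode (retractRun-DyckTail 1≤k t)
      retract-extend : ∀ {us} → DyckCode k (suc (suc r)) us → retract (extend us) ≡ us
      retract-extend c with DyckCode⇒DyckTail 1≤k c
      ... | xs , refl , t =
        cong (0 ∷_) (retractRun-extendRun xs runShape z≤n admissible (subst (0 <_) (sym ret≡) (s≤s z≤n)))
        where open DyckTail t
      extend-retract : ∀ {us} → DyckCode (suc k) (suc r) us → extend (retract us) ≡ us
      extend-retract c with DyckCode⇒DyckTail (s≤s z≤n) c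
      ... | ys , refl , t = cong (0 ∷_) (extendRun-retractRun ys runShape 1≤k z≤n)
        where open DyckTail t

card-shift : ∀ m n .{{_ : NonZero n}} → 2 ≤ m / n → ∀ ℓ k → 1 ≤ k →
  card m n k (suc ℓ) ≡ card m n (k + ℓ) 1
card-shift m n two≤m/n zero    k _   = cong (λ j → card m n j 1) (sym (+-identityʳ k))
card-shift m n two≤m/n (suc ℓ) k 1≤k = begin
  card m n k (suc (suc ℓ))  ≡⟨ card-step k ℓ 1≤k ⟩
  card m n (suc k) (suc ℓ)  ≡⟨ card-shift m n two≤m/n ℓ (suc k) (s≤s z≤n) ⟩
  card m n (suc k + ℓ) 1    ≡⟨ cong (λ j → card m n j 1) (+-suc k ℓ) ⟨
  card m n (k + suc ℓ) 1    ∎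
  where
  open ≡-Reasoning
  open RunShift m n two≤m/n using (card-step)

corollary3p4 : (m n k ℓ : ℕ) → .{{_ : NonZero n}} →
    1 ≤ m → 1 ≤ k → 1 ≤ ℓ → 2 ≤ m / n →
    card m n k ℓ ≡ card m n (k + ℓ ∸ 1) 1
-- The hypothesis 1 ≤ m is implied by 2 ≤ m / n.
corollary3p4 m n k zero    _ _   ()  _
corollary3p4 m n k (suc ℓ) _ 1≤k _ two≤m/n =
  trans (card-shift m n two≤m/n ℓ k 1≤k) (cong (λ j → card m n (j ∸ 1) 1) (sym (+-suc k ℓ)))
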